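{- Let $A$ be a set and $F\colon\mathsf{Set}\to\mathsf{Set}$, $FX=2\times(X+\{\bot\})^A$ with $2=\{0,1\}$. Let $(C,\langle o,\delta\rangle,q_0)$ be a pointed $F$-coalgebra (a partial deterministic automaton with initial state $q_0\in C$). Then its coalgebra of defined inputs $(P,\langle\bar o,\bar\delta\rangle,\varepsilon)$ is a tree.
   Context: Pointed coalgebras in $\mathsf{Set}$ use $I=1$, so a point is an element. Extend $\delta\colon C\to(C+\{\bot\})^A$ to $\delta^*\colon C\to(C+\{\bot\})^{A^*}$ by $\delta^*(q)(\varepsilon)=\mathsf{inl}(q)$, and $\delta^*(q)(wa)=\delta(q')(a)$ if $\delta^*(q)(w)=\mathsf{inl}(q')$, $\delta^*(q)(wa)=\mathsf{inr}(\bot)$ otherwise. The coalgebra of defined inputs is: $P=\{w\in A^*\mid \exists q\in C:\delta^*(q_0)(w)=\mathsf{inl}(q)\}$, $\bar o(w)=o(q)$ where $\delta^*(q_0)(w)=\mathsf{inl}(q)$, $\bar\delta(w)(a)=\mathsf{inl}(wa)$ if $wa\in P$ and $\bar\delta(w)(a)=\mathsf{inr}(\bot)$ otherwise, with point the empty word $\varepsilon$. A pointed coalgebra morphism $h\colon(T,t,x)\to(C,c,y)$ is a map with $c\cdot h=Fh\cdot t$ and $h(x)=y$; it is a split epimorphism of pointed coalgebras if there is a pointed coalgebra morphism $s$ with $h\cdot s=\mathrm{id}$. A pointed coalgebra is a tree if every pointed coalgebra morphism into it is a split epimorphism of pointed coalgebras. -}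

module Defs where

open import Data.Bool using (Bool)
open import Data.Unit using (⊤; tt)
open import Data.Empty using (⊥)
open import Data.Sum using (_⊎_; inj₁; inj₂)
open import Data.Product using (Σ; _×_; _,_; proj₁; proj₂)
open import Relation.Binary.PropositionalEquality using (_≡_)

-- X + {⊥}, with {⊥} represented by the unit type ⊤ (inr(⊥) = inj₂ tt).
_+⊥ : Set → Set
X +⊥ = X ⊎ ⊤

F : Set → Set → Set
F A X = Bool × (A → X +⊥)

map+⊥ : {X Y : Set} → (X → Y) → X +⊥ → Y +⊥
map+⊥ h (inj₁ x) = inj₁ (h x)
map+⊥ h (inj₂ u) = inj₂ u

Fmap : {A X Y : Set} → (X → Y) → F A X → F A Y
Fmap h (b , f) = b , λ a → map+⊥ h (f a)

_≈F_ : {A X : Set} → F A X → F A X → Set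
_≈F_ {A} (b , f) (b' , f') = (b ≡ b') × ((a : A) → f a ≡ f' a)

-- Pointed F-coalgebras in Set (I = 1, so the point is an element).
record PCoalg (A : Set) : Set₁ where
  constructor pcoalg
  field
    Carrier : Set
    str     : Carrier → F A Carrier
    point   : Carrier
open PCoalg public

record PMor {A : Set} (T Cc : PCoalg A) : Set where
  constructor pmor
  field
    fun       : Carrier T → Carrier Cc
    coalg-hom : (x : Carrier T) → str Cc (fun x) ≈F Fmap fun (str T x)
    pres-pt   : fun (point T) ≡ point Cc
open PMor public

IsSplitEpi : {A : Set} {T Cc : PCoalg A} → PMor T Cc → Set
IsSplitEpi {A} {T} {Cc} h =
  Σ (PMor Cc T) λ s → (y : Carrier Cc) → fun h (fun s y) ≡ y

IsTree : {A : Set} → PCoalg A → Set₁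
IsTree {A} Cc = (T : PCoalg A) (h : PMor T Cc) → IsSplitEpi h

data Word (A : Set) : Set where
  ε   : Word A
  _·_ : Word A → A → Word A

δ* : {A C : Set} → (C → A → C +⊥) → C → Word A → C +⊥
δ* δ q ε = inj₁ q
δ* δ q (w · a) with δ* δ q w
... | inj₁ q' = δ q' a
... | inj₂ _  = inj₂ tt

IsInl : {C : Set} → C +⊥ → Set
IsInl (inj₁ _) = ⊤
IsInl (inj₂ _) = ⊥

getInl : {C : Set} (x : C +⊥) → IsInl x → C
getInl (inj₁ q) _ = q

ifInl : {C R : Set} (x : C +⊥) → (IsInl x → R) → R → R
ifInl (inj₁ q) yes no = yes tt
ifInl (inj₂ _) yes no = no

module DefinedInputs {A : Set} (Cc : PCoalg A) where
  C = Carrier Cc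
  o : C → Bool
  o q = proj₁ (str Cc q)
  δ : C → A → C +⊥
  δ q = proj₂ (str Cc q)
  q₀ : C
  q₀ = point Cc

  P : Set
  P = Σ (Word A) λ w → IsInl (δ* δ q₀ w)

  ō : P → Bool
  ō (w , d) = o (getInl (δ* δ q₀ w) d)

  δ̄ : P → A → P +⊥
  δ̄ (w , _) a = ifInl (δ* δ q₀ (w · a)) (λ d → inj₁ ((w · a) , d)) (inj₂ tt)

  DefIn : PCoalg A
  DefIn = pcoalg P (λ p → ō p , δ̄ p) (ε , tt)

{-# OPTIONS --safe #-}
-- Let h : T → P be a morphism. If a state t of T lies over w and wa ∈ P, the
-- homomorphism condition at t forces an a-successor of t lying over wa; so by
-- induction on w, following the transitions of T from its point yields a state
-- over every w ∈ P, i.e. a section s of h. It is a coalgebra morphism because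
-- when wa ∉ P the same condition forces t to have no a-successor.
module Submission where

open import Defs
open import Data.Unit using (tt)
open import Data.Empty using (⊥-elim)
open import Data.Sum using (_⊎_; inj₁; inj₂)
open import Data.Sum.Properties using (inj₁-injective)
open import Data.Product using (Σ; ∃; _×_; _,_; proj₁; proj₂)
open import Relation.Binary.PropositionalEquality

IsInl-irrelevant : {C : Set} (x : C +⊥) (d d′ : IsInl x) → d ≡ d′
IsInl-irrelevant (inj₁ _) _ _ = refl

ifInl-inl : {C R : Set} (x : C +⊥) (d : IsInl x) {k : IsInl x → R} {n : R} →
            ifInl x k n ≡ k d
ifInl-inl (inj₁ _) _ = refl

ifInl-view : {C R : Set} (x : C +⊥) {k : IsInl x → R} {n : R} →
             (Σ (IsInl x) λ d → ifInl x k n ≡ k d) ⊎ ifInl x k n ≡ n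
ifInl-view (inj₁ _) = inj₁ (tt , refl)
ifInl-view (inj₂ _) = inj₂ refl

map+⊥-inj₁⁻¹ : {X Y : Set} (g : X → Y) (x : X +⊥) {y : Y} →
               map+⊥ g x ≡ inj₁ y → ∃ λ x′ → x ≡ inj₁ x′ × g x′ ≡ y
map+⊥-inj₁⁻¹ g (inj₁ x′) eq = x′ , refl , inj₁-injective eq

map+⊥-inj₂⁻¹ : {X Y : Set} (g : X → Y) (x : X +⊥) →
               map+⊥ g x ≡ inj₂ tt → x ≡ inj₂ tt
map+⊥-inj₂⁻¹ g (inj₂ tt) _ = refl

δ*-defined-prefix : {A C : Set} (δ : C → A → C +⊥) (q : C) (w : Word A) (a : A) →
                    IsInl (δ* δ q (w · a)) → IsInl (δ* δ q w)
δ*-defined-prefix δ q w a d with δ* δ q w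
... | inj₁ _ = tt
... | inj₂ _ = ⊥-elim d

module _ {A : Set} (Cc : PCoalg A) where
  open DefinedInputs Cc

  δ̄-defined : {w : Word A} (d : IsInl (δ* δ q₀ w)) {a : A} (d′ : IsInl (δ* δ q₀ (w · a))) →
              δ̄ (w , d) a ≡ inj₁ (w · a , d′)
  δ̄-defined {w} _ {a} d′ = ifInl-inl (δ* δ q₀ (w · a)) d′

  δ̄-view : (p : P) (a : A) →
           (Σ (IsInl (δ* δ q₀ (proj₁ p · a))) λ d′ → δ̄ p a ≡ inj₁ (proj₁ p · a , d′))
           ⊎ δ̄ p a ≡ inj₂ tt
  δ̄-view (w , _) a = ifInl-view (δ* δ q₀ (w · a))

module Section {A : Set} (Cc T : PCoalg A) (h : PMor T (DefinedInputs.DefIn Cc)) where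
  open DefinedInputs Cc

  next : Carrier T → A → Carrier T +⊥
  next t = proj₂ (str T t)

  Fiber : P → Set
  Fiber p = Σ (Carrier T) λ t → fun h t ≡ p

  next-over : {p : P} (f : Fiber p) (a : A) →
              map+⊥ (fun h) (next (proj₁ f) a) ≡ δ̄ p a
  next-over (t , refl) a = sym (proj₂ (coalg-hom h t) a)

  fiber-step : {w : Word A} {d : IsInl (δ* δ q₀ w)} (f : Fiber (w , d))
               (a : A) (d′ : IsInl (δ* δ q₀ (w · a))) →
               Σ (Fiber (w · a , d′)) λ f′ → next (proj₁ f) a ≡ inj₁ (proj₁ f′)
  fiber-step {d = d} f a d′ =
    let t′ , next≡ , ht′ = map+⊥-inj₁⁻¹ (fun h) (next (proj₁ f) a)
                             (trans (next-over f a) (δ̄-defined Cc d d′))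
    in (t′ , ht′) , next≡

  fiber : (w : Word A) (d : IsInl (δ* δ q₀ w)) → Fiber (w , d)
  fiber ε _ = point T , pres-pt h
  fiber (w · a) d = proj₁ (fiber-step (fiber w (δ*-defined-prefix δ q₀ w a d)) a d)

  section : P → Carrier T
  section (w , d) = proj₁ (fiber w d)

  next-section : (w : Word A) (d : IsInl (δ* δ q₀ w)) (a : A) (d′ : IsInl (δ* δ q₀ (w · a))) →
                 next (section (w , d)) a ≡ inj₁ (section (w · a , d′))
  next-section w d a d′ rewrite IsInl-irrelevant _ d (δ*-defined-prefix δ q₀ w a d′) =
    proj₂ (fiber-step (fiber w _) a d′)

  section-hom : (p : P) → str T (section p) ≈F Fmap section (str DefIn p)
  section-hom (w , d) = output , transition
    where
    f = fiber w d
    t = proj₁ f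

    output : proj₁ (str T t) ≡ ō (w , d)
    output = sym (trans (cong ō (sym (proj₂ f))) (proj₁ (coalg-hom h t)))

    transition : (a : A) → next t a ≡ map+⊥ section (δ̄ (w , d) a)
    transition a with δ̄-view Cc (w , d) a
    ... | inj₁ (d′ , δ̄≡) rewrite δ̄≡ = next-section w d a d′
    ... | inj₂ δ̄≡ rewrite δ̄≡ =
      map+⊥-inj₂⁻¹ (fun h) (next t a) (trans (next-over f a) δ̄≡)

  section-mor : PMor DefIn T
  section-mor = pmor section section-hom refl

  section-split : IsSplitEpi h
  section-split = section-mor , λ (w , d) → proj₂ (fiber w d)

lemma5p9 : (A : Set) (Cc : PCoalg A) → IsTree (DefinedInputs.DefIn Cc)
lemma5p9 A Cc T h = Section.section-split Cc T h
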